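{- Let $x>y$ be positive integers and let $P(G,x,y)$ denote the number of generalized colorings of a finite multigraph $G$ with $x$ colors of which $y$ are proper. Then for every finite multigraph $G$ and every edge $e$ of $G$, $$P(G,x,y)=P(G_{ -e},x,y)-P(G_{/e},x,y)+(x-y)\,P(G_{\dagger e},x,y),$$ and moreover $P(G_1\oplus G_2,x,y)=P(G_1,x,y)P(G_2,x,y)$, $P(E_1,x,y)=x$, $P(\emptyset,x,y)=1$.
   Context: Let $X$ be a set of $x$ colors and $Y\subseteq X$ a subset of $y$ "proper" colors. A generalized coloring of a multigraph $G=(V,E)$ is a map $\phi:V\to X$ such that for every edge $\{u,v\}$ with $u\neq v$, if $\phi(u)\in Y$ and $\phi(v)\in Y$ then $\phi(u)\neq\phi(v)$; a vertex carrying a self-loop must receive a color in $X\setminus Y$; multiple edges impose the same condition as a single edge. For an edge $e$: $G_{ -e}$ removes $e$; $G_{/e}$ identifies the endpoints of $e$ (removing $e$); $G_{\dagger e}$ is the subgraph induced by $V\setminus\{u,v\}$ where $e=\{u,v\}$. $G_1\oplus G_2$ is disjoint union, $E_1$ the one-vertex edgeless graph, $\emptyset$ the graph with no vertices. -}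

module Defs where

open import Data.Nat using (ℕ; zero; suc; _+_; _<_; _≤_)
open import Data.Nat.Properties using (_<?_)
open import Data.Fin using (Fin; toℕ; punchOut; _↑ˡ_; _↑ʳ_)
open import Data.Fin.Properties using (_≟_)
open import Data.Product using (_×_; _,_; proj₁; proj₂)
open import Data.List using (List; []; _∷_; length; map; mapMaybe; filter; concatMap; lookup; removeAt; _++_)
open import Data.List.Relation.Unary.All using (All)
open import Data.List.Relation.Unary.All as All using (all?)
open import Data.Maybe using (Maybe; just; nothing)
open import Data.Vec using (Vec; []; _∷_)
open import Data.Vec as Vec using ()
open import Data.Empty using (⊥)
open import Relation.Nullary using (¬_; Dec; yes; no)
open import Relation.Nullary.Decidable using (_×-dec_; _→-dec_; ¬?)
open import Relation.Binary.PropositionalEquality using (_≡_; _≢_; refl; sym)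
import Data.List as L

-- Finite multigraphs (loops and parallel edges allowed).
-- Vertices are Fin n; edges form a list of (unordered) endpoint pairs,
-- so an edge of G is an index e : Fin (length (edges G)).

record Graph : Set where
  constructor graph
  field
    n     : ℕ
    edges : List (Fin n × Fin n)
open Graph public

Edge : Graph → Set
Edge G = Fin (length (edges G))

endpoints : (G : Graph) → Edge G → Fin (n G) × Fin (n G)
endpoints G e = lookup (edges G) e

-- Generalized colorings.  The colour set is X = Fin x and the proper
-- colours are Y = { c | toℕ c < y } (the first y colours).

InY : {x : ℕ} (y : ℕ) → Fin x → Set
InY y c = toℕ c < y

EdgeOK : ∀ {m x} (y : ℕ) → (Fin m → Fin x) → Fin m × Fin m → Set
EdgeOK y φ (a , b) =
  (a ≡ b → ¬ InY y (φ a)) ×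
  (a ≢ b → InY y (φ a) → InY y (φ b) → φ a ≢ φ b)

IsGenColoring : (G : Graph) (x y : ℕ) → (Fin (n G) → Fin x) → Set
IsGenColoring G x y φ = All (EdgeOK y φ) (edges G)

edgeOK? : ∀ {m x} (y : ℕ) (φ : Fin m → Fin x) (p : Fin m × Fin m) → Dec (EdgeOK y φ p)
edgeOK? y φ (a , b) =
  ((a ≟ b) →-dec ¬? (toℕ (φ a) <? y)) ×-dec
  (¬? (a ≟ b) →-dec ((toℕ (φ a) <? y) →-dec ((toℕ (φ b) <? y) →-dec ¬? (φ a ≟ φ b))))

-- list of all maps Fin m → Fin x, represented as vectors (φ = Vec.lookup v)
allVecs : (m x : ℕ) → List (Vec (Fin x) m)
allVecs zero    x = [] ∷ []
allVecs (suc m) x = concatMap (λ c → map (c ∷_) (allVecs m x)) (L.allFin x)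

isGenColoring? : (G : Graph) (x y : ℕ) (v : Vec (Fin x) (n G)) →
                 Dec (IsGenColoring G x y (Vec.lookup v))
isGenColoring? G x y v = all? (edgeOK? y (Vec.lookup v)) (edges G)

P : Graph → ℕ → ℕ → ℕ
P G x y = length (filter (isGenColoring? G x y) (allVecs (n G) x))

deleteEdge : (G : Graph) → Edge G → Graph
deleteEdge (graph m es) e = graph m (removeAt es e)

mergeMap : ∀ {m} {u v : Fin (suc m)} → u ≢ v → Fin (suc m) → Fin m
mergeMap {u = u} {v = v} u≢v w with w ≟ v
... | yes _   = punchOut {i = v} {j = u} (λ v≡u → u≢v (sym v≡u))
... | no w≢v  = punchOut {i = v} {j = w} (λ v≡w → w≢v (sym v≡w))

deleteVertex : ∀ {m} → Fin (suc m) → List (Fin (suc m) × Fin (suc m)) → List (Fin m × Fin m)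
deleteVertex {m} v = mapMaybe keep
  where
  keep : Fin (suc m) × Fin (suc m) → Maybe (Fin m × Fin m)
  keep (a , b) with v ≟ a | v ≟ b
  ... | no v≢a | no v≢b = just (punchOut v≢a , punchOut v≢b)
  ... | _      | _      = nothing

-- G_{/e}: identify the endpoints of e and remove e (other edges parallel
-- to e become loops).  If e is a loop, this just removes e.
contractAux : (m : ℕ) (es : List (Fin m × Fin m)) → Fin (length es) → Graph
contractAux zero    es e with lookup es e
... | () , _
contractAux (suc m) es e with lookup es e
... | (u , v) with u ≟ v
...   | yes _   = graph (suc m) (removeAt es e)
...   | no u≢v  = graph m (map (λ { (a , b) → (mergeMap u≢v a , mergeMap u≢v b) }) (removeAt es e))

contract : (G : Graph) → Edge G → Graph
contract (graph m es) e = contractAux m es e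

-- G_{†e}: subgraph induced by V ∖ {u , v} where e = {u , v}
daggerAux : (m : ℕ) (es : List (Fin m × Fin m)) → Fin (length es) → Graph
daggerAux zero    es e with lookup es e
... | () , _
daggerAux (suc m) es e with lookup es e
... | (u , v) with u ≟ v
...   | yes _   = graph m (deleteVertex u es)
daggerAux (suc zero)    es e | (u , v) | no u≢v = graph zero []   -- impossible: Fin 1 has one element
daggerAux (suc (suc m)) es e | (u , v) | no u≢v =
        graph m (deleteVertex (punchOut {i = v} {j = u} (λ v≡u → u≢v (sym v≡u))) (deleteVertex v es))

dagger : (G : Graph) → Edge G → Graph
dagger (graph m es) e = daggerAux m es e

_⊕_ : Graph → Graph → Graph
graph m₁ es₁ ⊕ graph m₂ es₂ =
  graph (m₁ + m₂) (map (λ { (a , b) → (a ↑ˡ m₂ , b ↑ˡ m₂) }) es₁ ++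
                   map (λ { (a , b) → (m₁ ↑ʳ a , m₁ ↑ʳ b) }) es₂)

E₁ : Graph
E₁ = graph 1 []

∅G : Graph
∅G = graph 0 []

module Submission where

-- A map φ : V → X is weighted by  ∏_{edges p} [φ satisfies the condition
-- of p],  so P(G,x,y) is the total weight of all maps ('P-as-total').  For e = {u,v}, u ≢ v, split colourings by
--     the colour c of v and d of u; then
--       [e satisfied] + [c = d] = 1 + [c = d]·[c improper]   ('edgeWeight-split')
--     and a colouring with u, v both of the improper colour c is a colouring
--     of G_{†e}.

open import Defs
open import Data.Nat using (ℕ; _<_)
import Data.Nat
open import Data.Product using (_×_)
open import Relation.Binary.PropositionalEquality using (_≡_)

module Counting where

  open import Data.Nat using (zero; suc; _+_; _*_; _∸_; s≤s; s≤s⁻¹)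
  open import Data.Nat.Properties
    using (_<?_; +-*-semiring; +-identityʳ; +-comm; *-comm; *-assoc; *-distribʳ-+)
  open import Data.Nat.ListAction using (sum; product)
  open import Data.Nat.ListAction.Properties using (sum-++; product-++)
  open import Data.Fin using (Fin; zero; suc; toℕ; punchOut; _↑ˡ_; _↑ʳ_)
  open import Data.Fin.Properties using (_≟_; suc-injective; punchIn-punchOut; punchOut-cong; ↑ˡ-injective; ↑ʳ-injective)
  open import Data.Product using (_,_; proj₁; proj₂)
  open import Data.Sum using (_⊎_; inj₁; inj₂; [_,_]′)
  open import Data.List using (List; []; _∷_; length; map; filter; concatMap; tabulate; lookup; removeAt; _++_)
  import Data.List as List
  import Data.List.Properties as List
  open import Data.List.Relation.Unary.All using ([]; _∷_; all?)
  open import Data.Vec using (Vec; []; _∷_; insertAt)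
  import Data.Vec as Vec
  import Data.Vec.Properties as Vec
  open import Data.Empty using (⊥-elim)
  open import Relation.Nullary using (¬_; Dec; yes; no)
  open import Relation.Nullary.Decidable using (_×-dec_; ¬?)
  open import Relation.Binary.PropositionalEquality
    using (_≢_; refl; sym; trans; cong; cong₂; subst; module ≡-Reasoning)
  open import Algebra.Properties.Semiring.Sum +-*-semiring
    using (sum-syntax; sum-cong-≗; ∑-distrib-+; ∑-comm; *-distribˡ-sum; *-distribʳ-sum; sum-replicate-zero)
  open import Data.Nat.Solver using (module +-*-Solver)

  open ≡-Reasoning

  𝟙 : ∀ {a} {A : Set a} → Dec A → ℕ
  𝟙 (yes _) = 1
  𝟙 (no _)  = 0

  𝟙-cong : ∀ {a b} {A : Set a} {B : Set b} → (A → B) → (B → A) →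
           (da : Dec A) (db : Dec B) → 𝟙 da ≡ 𝟙 db
  𝟙-cong f g (yes _) (yes _) = refl
  𝟙-cong f g (yes a) (no ¬b) = ⊥-elim (¬b (f a))
  𝟙-cong f g (no ¬a) (yes b) = ⊥-elim (¬a (g b))
  𝟙-cong f g (no _)  (no _)  = refl

  𝟙-yes : ∀ {a} {A : Set a} → A → (d : Dec A) → 𝟙 d ≡ 1
  𝟙-yes a (yes _) = refl
  𝟙-yes a (no ¬a) = ⊥-elim (¬a a)

  𝟙-no : ∀ {a} {A : Set a} → ¬ A → (d : Dec A) → 𝟙 d ≡ 0
  𝟙-no ¬a (yes a) = ⊥-elim (¬a a)
  𝟙-no ¬a (no _)  = refl

  𝟙-× : ∀ {a b} {A : Set a} {B : Set b} (da : Dec A) (db : Dec B) (dab : Dec (A × B)) →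
        𝟙 dab ≡ 𝟙 da * 𝟙 db
  𝟙-× (yes a) (yes b) dab = 𝟙-yes (a , b) dab
  𝟙-× (yes _) (no ¬b) dab = 𝟙-no (λ ab → ¬b (proj₂ ab)) dab
  𝟙-× (no ¬a) db      dab = 𝟙-no (λ ab → ¬a (proj₁ ab)) dab

  ∑-delta : ∀ k (d : Fin k) (h : Fin k → ℕ) → ∑[ i < k ] (𝟙 (i ≟ d) * h i) ≡ h d
  ∑-delta (suc k) zero h = begin
    h zero + 0 + ∑[ i < k ] (0 * h (suc i))  ≡⟨ cong (h zero + 0 +_) (sum-replicate-zero k) ⟩
    h zero + 0 + 0                           ≡⟨ trans (+-identityʳ _) (+-identityʳ _) ⟩
    h zero                                   ∎
  ∑-delta (suc k) (suc d) h = begin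
    0 * h zero + ∑[ i < k ] (𝟙 (suc i ≟ suc d) * h (suc i))
      ≡⟨ sum-cong-≗ (λ i → cong (_* h (suc i)) (𝟙-cong suc-injective (cong suc) (suc i ≟ suc d) (i ≟ d))) ⟩
    ∑[ i < k ] (𝟙 (i ≟ d) * h (suc i))  ≡⟨ ∑-delta k d (λ i → h (suc i)) ⟩
    h (suc d)                           ∎

  ∑-delta′ : ∀ k (d : Fin k) (h : Fin k → ℕ) → ∑[ i < k ] (𝟙 (d ≟ i) * h i) ≡ h d
  ∑-delta′ k d h = trans (sum-cong-≗ (λ i → cong (_* h i) (𝟙-cong sym sym (d ≟ i) (i ≟ d)))) (∑-delta k d h)

  ∑-ones : ∀ k → ∑[ i < k ] 1 ≡ k
  ∑-ones zero    = refl
  ∑-ones (suc k) = cong suc (∑-ones k)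

  improper : ∀ {x} (y : ℕ) → Fin x → ℕ
  improper y c = 𝟙 (¬? (toℕ c <? y))

  ∑-improper : ∀ x y → ∑[ c < x ] improper y c ≡ x ∸ y
  ∑-improper zero    zero    = refl
  ∑-improper zero    (suc y) = refl
  ∑-improper (suc x) zero    = cong suc (∑-improper x zero)
  ∑-improper (suc x) (suc y) = begin
    ∑[ c < x ] improper (suc y) (suc c)  ≡⟨ sum-cong-≗ shift ⟩
    ∑[ c < x ] improper y c              ≡⟨ ∑-improper x y ⟩
    x ∸ y                                ∎
    where
    shift : ∀ (c : Fin x) → improper (suc y) (suc c) ≡ improper y c
    shift c = 𝟙-cong (λ ¬c<y c<y → ¬c<y (s≤s c<y)) (λ ¬c<y c<y → ¬c<y (s≤s⁻¹ c<y))
                     (¬? (suc (toℕ c) <? suc y)) (¬? (toℕ c <? y))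

  count-filter : ∀ {a p} {A : Set a} {Q : A → Set p} (d : ∀ a → Dec (Q a)) (xs : List A) →
                 length (filter d xs) ≡ sum (map (λ a → 𝟙 (d a)) xs)
  count-filter d [] = refl
  count-filter d (a ∷ xs) with d a
  ... | yes _ = cong suc (count-filter d xs)
  ... | no _  = count-filter d xs

  sum-concatMap : ∀ {A B : Set} (F : B → ℕ) (h : A → List B) (xs : List A) →
                  sum (map F (concatMap h xs)) ≡ sum (map (λ a → sum (map F (h a))) xs)
  sum-concatMap F h [] = refl
  sum-concatMap F h (a ∷ xs) = begin
    sum (map F (h a ++ concatMap h xs))            ≡⟨ cong sum (List.map-++ F (h a) (concatMap h xs)) ⟩
    sum (map F (h a) ++ map F (concatMap h xs))    ≡⟨ sum-++ (map F (h a)) _ ⟩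
    sum (map F (h a)) + sum (map F (concatMap h xs)) ≡⟨ cong (sum (map F (h a)) +_) (sum-concatMap F h xs) ⟩
    sum (map (λ a → sum (map F (h a))) (a ∷ xs))   ∎

  sum-tabulate : ∀ {A : Set} k (f : Fin k → A) (g : A → ℕ) →
                 sum (map g (tabulate f)) ≡ ∑[ i < k ] g (f i)
  sum-tabulate zero    f g = refl
  sum-tabulate (suc k) f g = cong (g (f zero) +_) (sum-tabulate k (λ i → f (suc i)) g)

  module Colourings (x : ℕ) where

    total : (m : ℕ) → (Vec (Fin x) m → ℕ) → ℕ
    total zero    F = F []
    total (suc m) F = ∑[ c < x ] total m (λ w → F (c ∷ w))

    total-cong : ∀ m {F G : Vec (Fin x) m → ℕ} → (∀ w → F w ≡ G w) → total m F ≡ total m G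
    total-cong zero    F≗G = F≗G []
    total-cong (suc m) F≗G = sum-cong-≗ (λ c → total-cong m (λ w → F≗G (c ∷ w)))

    total-+ : ∀ m (F G : Vec (Fin x) m → ℕ) → total m (λ w → F w + G w) ≡ total m F + total m G
    total-+ zero    F G = refl
    total-+ (suc m) F G = trans (sum-cong-≗ (λ c → total-+ m (λ w → F (c ∷ w)) (λ w → G (c ∷ w))))
                               (∑-distrib-+ (λ c → total m (λ w → F (c ∷ w))) (λ c → total m (λ w → G (c ∷ w))))

    total-*ˡ : ∀ m a (F : Vec (Fin x) m → ℕ) → total m (λ w → a * F w) ≡ a * total m F
    total-*ˡ zero    a F = refl
    total-*ˡ (suc m) a F = trans (sum-cong-≗ (λ c → total-*ˡ m a (λ w → F (c ∷ w))))
                                (sym (*-distribˡ-sum a (λ c → total m (λ w → F (c ∷ w)))))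

    total-*ʳ : ∀ m a (F : Vec (Fin x) m → ℕ) → total m (λ w → F w * a) ≡ total m F * a
    total-*ʳ zero    a F = refl
    total-*ʳ (suc m) a F = trans (sum-cong-≗ (λ c → total-*ʳ m a (λ w → F (c ∷ w))))
                                (sym (*-distribʳ-sum a (λ c → total m (λ w → F (c ∷ w)))))

    total-∑ : ∀ m k (g : Fin k → Vec (Fin x) m → ℕ) →
              total m (λ w → ∑[ i < k ] g i w) ≡ ∑[ i < k ] total m (g i)
    total-∑ zero    k g = refl
    total-∑ (suc m) k g = trans (sum-cong-≗ (λ c → total-∑ m k (λ i w → g i (c ∷ w))))
                              (∑-comm (λ c i → total m (λ w → g i (c ∷ w))))

    total-insertAt : ∀ m (v : Fin (suc m)) (F : Vec (Fin x) (suc m) → ℕ) →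
                     total (suc m) F ≡ ∑[ c < x ] total m (λ w → F (insertAt w v c))
    total-insertAt m       zero    F = refl
    total-insertAt (suc m) (suc v) F = begin
      ∑[ d < x ] total (suc m) (λ w → F (d ∷ w))
        ≡⟨ sum-cong-≗ (λ d → total-insertAt m v (λ w → F (d ∷ w))) ⟩
      ∑[ d < x ] ∑[ c < x ] total m (λ w → F (d ∷ insertAt w v c))
        ≡⟨ ∑-comm (λ d c → total m (λ w → F (d ∷ insertAt w v c))) ⟩
      ∑[ c < x ] ∑[ d < x ] total m (λ w → F (d ∷ insertAt w v c)) ∎

    total-++ : ∀ m₁ m₂ (F : Vec (Fin x) (m₁ + m₂) → ℕ) →
               total (m₁ + m₂) F ≡ total m₁ (λ u → total m₂ (λ v → F (u Vec.++ v)))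
    total-++ zero     m₂ F = refl
    total-++ (suc m₁) m₂ F = sum-cong-≗ (λ c → total-++ m₁ m₂ (λ w → F (c ∷ w)))

    total-allVecs : ∀ m (F : Vec (Fin x) m → ℕ) → sum (map F (allVecs m x)) ≡ total m F
    total-allVecs zero    F = +-identityʳ (F [])
    total-allVecs (suc m) F = begin
      sum (map F (concatMap (λ c → map (c ∷_) (allVecs m x)) (List.allFin x)))
        ≡⟨ sum-concatMap F _ (List.allFin x) ⟩
      sum (map (λ c → sum (map F (map (c ∷_) (allVecs m x)))) (List.allFin x))
        ≡⟨ sum-tabulate x (λ c → c) _ ⟩
      ∑[ c < x ] sum (map F (map (c ∷_) (allVecs m x)))
        ≡⟨ sum-cong-≗ (λ c → trans (cong sum (sym (List.map-∘ (allVecs m x))))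
                                   (total-allVecs m (λ w → F (c ∷ w)))) ⟩
      total (suc m) F ∎

  module Weights (x y : ℕ) where
    open Colourings x

    edgeWeight : ∀ {m} → (Fin m → Fin x) → Fin m × Fin m → ℕ
    edgeWeight φ p = 𝟙 (edgeOK? y φ p)

    weight : ∀ {m} → (Fin m → Fin x) → List (Fin m × Fin m) → ℕ
    weight φ es = product (map (edgeWeight φ) es)

    W : ∀ {m} → List (Fin m × Fin m) → Vec (Fin x) m → ℕ
    W es w = weight (Vec.lookup w) es

    𝟙-all : ∀ {m} (φ : Fin m → Fin x) es → 𝟙 (all? (edgeOK? y φ) es) ≡ weight φ es
    𝟙-all φ [] = refl
    𝟙-all φ (p ∷ es) = begin
      𝟙 (all? (edgeOK? y φ) (p ∷ es))
        ≡⟨ 𝟙-cong (λ { (ok ∷ oks) → ok , oks }) (λ { (ok , oks) → ok ∷ oks })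
                  (all? (edgeOK? y φ) (p ∷ es)) (edgeOK? y φ p ×-dec all? (edgeOK? y φ) es) ⟩
      𝟙 (edgeOK? y φ p ×-dec all? (edgeOK? y φ) es)
        ≡⟨ 𝟙-× (edgeOK? y φ p) (all? (edgeOK? y φ) es) _ ⟩
      edgeWeight φ p * 𝟙 (all? (edgeOK? y φ) es)
        ≡⟨ cong (edgeWeight φ p *_) (𝟙-all φ es) ⟩
      weight φ (p ∷ es) ∎

    P-as-total : ∀ G → P G x y ≡ total (n G) (W (edges G))
    P-as-total G = begin
      length (filter (isGenColoring? G x y) (allVecs (n G) x))
        ≡⟨ count-filter (isGenColoring? G x y) (allVecs (n G) x) ⟩
      sum (map (λ w → 𝟙 (isGenColoring? G x y w)) (allVecs (n G) x))
        ≡⟨ cong sum (List.map-cong (λ w → 𝟙-all (Vec.lookup w) (edges G)) (allVecs (n G) x)) ⟩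
      sum (map (W (edges G)) (allVecs (n G) x))
        ≡⟨ total-allVecs (n G) (W (edges G)) ⟩
      total (n G) (W (edges G)) ∎

    weight-++ : ∀ {m} (φ : Fin m → Fin x) es fs → weight φ (es ++ fs) ≡ weight φ es * weight φ fs
    weight-++ φ es fs = trans (cong product (List.map-++ (edgeWeight φ) es fs))
                             (product-++ (map (edgeWeight φ) es) (map (edgeWeight φ) fs))

    weight-removeAt : ∀ {m} (φ : Fin m → Fin x) es (e : Fin (length es)) →
                      weight φ es ≡ edgeWeight φ (lookup es e) * weight φ (removeAt es e)
    weight-removeAt φ (p ∷ es) zero    = refl
    weight-removeAt φ (p ∷ es) (suc e) = begin
      edgeWeight φ p * weight φ es        ≡⟨ cong (edgeWeight φ p *_) (weight-removeAt φ es e) ⟩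
      edgeWeight φ p * (a * b)            ≡⟨ sym (*-assoc (edgeWeight φ p) a b) ⟩
      edgeWeight φ p * a * b              ≡⟨ cong (_* b) (*-comm (edgeWeight φ p) a) ⟩
      a * edgeWeight φ p * b              ≡⟨ *-assoc a (edgeWeight φ p) b ⟩
      a * (edgeWeight φ p * b)            ∎
      where
      a b : ℕ
      a = edgeWeight φ (lookup es e)
      b = weight φ (removeAt es e)

    weight-map : ∀ {k j} (φ : Fin k → Fin x) (ψ : Fin j → Fin x) (h : Fin k × Fin k → Fin j × Fin j) es →
                 (∀ p → edgeWeight ψ (h p) ≡ edgeWeight φ p) → weight ψ (map h es) ≡ weight φ es
    weight-map φ ψ h []       h-ok = refl
    weight-map φ ψ h (p ∷ es) h-ok = cong₂ _*_ (h-ok p) (weight-map φ ψ h es h-ok)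

    -- The condition of an edge depends only on the colours of its endpoints
    -- (and on whether it is a loop); an edge may be sent to a loop, as its
    -- endpoints then necessarily have equal colours.
    edgeWeight-transport : ∀ {k j} (φ : Fin k → Fin x) (ψ : Fin j → Fin x) (a b : Fin k) (a′ b′ : Fin j) →
                           φ a ≡ ψ a′ → φ b ≡ ψ b′ → (a ≡ b → a′ ≡ b′) →
                           edgeWeight φ (a , b) ≡ edgeWeight ψ (a′ , b′)
    edgeWeight-transport φ ψ a b a′ b′ φa φb a≡b⇒ = 𝟙-cong to from (edgeOK? y φ (a , b)) (edgeOK? y ψ (a′ , b′))
      where
      to : EdgeOK y φ (a , b) → EdgeOK y ψ (a′ , b′)
      to (loop , edge) = loop′ , edge′
        where
        loop′ : a′ ≡ b′ → ¬ InY y (ψ a′)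
        loop′ a′≡b′ ψa′∈Y with a ≟ b
        ... | yes a≡b = loop a≡b (subst (InY y) (sym φa) ψa′∈Y)
        ... | no  a≢b = edge a≢b (subst (InY y) (sym φa) ψa′∈Y)
                                 (subst (InY y) (sym (trans φb (cong ψ (sym a′≡b′)))) ψa′∈Y)
                                 (trans φa (trans (cong ψ a′≡b′) (sym φb)))
        edge′ : a′ ≢ b′ → InY y (ψ a′) → InY y (ψ b′) → ψ a′ ≢ ψ b′
        edge′ a′≢b′ ψa′∈Y ψb′∈Y same =
          edge (λ a≡b → a′≢b′ (a≡b⇒ a≡b)) (subst (InY y) (sym φa) ψa′∈Y) (subst (InY y) (sym φb) ψb′∈Y)
               (trans φa (trans same (sym φb)))
      from : EdgeOK y ψ (a′ , b′) → EdgeOK y φ (a , b)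
      from (loop , edge) = loop′ , edge′
        where
        loop′ : a ≡ b → ¬ InY y (φ a)
        loop′ a≡b φa∈Y = loop (a≡b⇒ a≡b) (subst (InY y) φa φa∈Y)
        edge′ : a ≢ b → InY y (φ a) → InY y (φ b) → φ a ≢ φ b
        edge′ a≢b φa∈Y φb∈Y same with a′ ≟ b′
        ... | yes a′≡b′ = loop a′≡b′ (subst (InY y) φa φa∈Y)
        ... | no  a′≢b′ = edge a′≢b′ (subst (InY y) φa φa∈Y) (subst (InY y) φb φb∈Y)
                               (trans (sym φa) (trans same φb))

    edgeWeight-improper : ∀ {k} (φ : Fin k → Fin x) (a b : Fin k) →
                          ¬ InY y (φ a) ⊎ ¬ InY y (φ b) → edgeWeight φ (a , b) ≡ 1
    edgeWeight-improper φ a b improperEnd = 𝟙-yes (loop , edge) (edgeOK? y φ (a , b))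
      where
      loop : a ≡ b → ¬ InY y (φ a)
      loop refl φa∈Y = [ (λ ¬φa∈Y → ¬φa∈Y φa∈Y) , (λ ¬φb∈Y → ¬φb∈Y φa∈Y) ]′ improperEnd
      edge : a ≢ b → InY y (φ a) → InY y (φ b) → φ a ≢ φ b
      edge _ φa∈Y φb∈Y _ = [ (λ ¬φa∈Y → ¬φa∈Y φa∈Y) , (λ ¬φb∈Y → ¬φb∈Y φb∈Y) ]′ improperEnd

    weight-drop : ∀ {m} (φ : Fin m → Fin x) p es → edgeWeight φ p ≡ 1 → weight φ (p ∷ es) ≡ weight φ es
    weight-drop φ p es p-free = trans (cong (_* weight φ es) p-free) (+-identityʳ _)

    lookup-insertAt-punchOut : ∀ {m} (w : Vec (Fin x) m) (v : Fin (suc m)) (c : Fin x) (a : Fin (suc m)) (v≢a : v ≢ a) →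
                               Vec.lookup (insertAt w v c) a ≡ Vec.lookup w (punchOut v≢a)
    lookup-insertAt-punchOut w v c a v≢a =
      trans (cong (Vec.lookup (insertAt w v c)) (sym (punchIn-punchOut v≢a))) (Vec.insertAt-punchIn w v c (punchOut v≢a))

    weight-deleteVertex : ∀ {m} (v : Fin (suc m)) (c : Fin x) → ¬ InY y c → (w : Vec (Fin x) m) (es : List (Fin (suc m) × Fin (suc m))) →
                          W es (insertAt w v c) ≡ W (deleteVertex v es) w
    weight-deleteVertex v c c∉Y w [] = refl
    weight-deleteVertex v c c∉Y w ((a , b) ∷ es) with v ≟ a | v ≟ b
    ... | no v≢a | no v≢b =
      cong₂ _*_ (edgeWeight-transport (Vec.lookup (insertAt w v c)) (Vec.lookup w) a b (punchOut v≢a) (punchOut v≢b)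
                   (lookup-insertAt-punchOut w v c a v≢a) (lookup-insertAt-punchOut w v c b v≢b) (punchOut-cong v))
                (weight-deleteVertex v c c∉Y w es)
    ... | yes refl | _ =
      trans (weight-drop (Vec.lookup (insertAt w v c)) (a , b) es
               (edgeWeight-improper (Vec.lookup (insertAt w v c)) a b
                  (inj₁ (subst (λ t → ¬ InY y t) (sym (Vec.insertAt-lookup w a c)) c∉Y))))
            (weight-deleteVertex v c c∉Y w es)
    ... | no _ | yes refl =
      trans (weight-drop (Vec.lookup (insertAt w v c)) (a , b) es
               (edgeWeight-improper (Vec.lookup (insertAt w v c)) a b
                  (inj₂ (subst (λ t → ¬ InY y t) (sym (Vec.insertAt-lookup w b c)) c∉Y))))
            (weight-deleteVertex v c c∉Y w es)

    edgeWeight-split : ∀ {k} (φ : Fin k → Fin x) (u v : Fin k) → u ≢ v → (c d : Fin x) → φ u ≡ d → φ v ≡ c →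
                       edgeWeight φ (u , v) + 𝟙 (c ≟ d) ≡ 1 + 𝟙 (c ≟ d) * improper y c
    edgeWeight-split φ u v u≢v c d φu φv with c ≟ d | toℕ c <? y
    ... | no c≢d   | _ =
      cong (_+ 0) (𝟙-yes ((λ u≡v → ⊥-elim (u≢v u≡v)) , (λ _ _ _ same → c≢d (trans (sym φv) (trans (sym same) φu))))
                         (edgeOK? y φ (u , v)))
    ... | yes refl | yes c∈Y =
      cong (_+ 1) (𝟙-no (λ ok → proj₂ ok u≢v (subst (InY y) (sym φu) c∈Y) (subst (InY y) (sym φv) c∈Y) (trans φu (sym φv)))
                        (edgeOK? y φ (u , v)))
    ... | yes refl | no c∉Y =
      cong (_+ 1) (edgeWeight-improper φ u v (inj₂ (subst (λ t → ¬ InY y t) (sym φv) c∉Y)))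

  module UnionAndBaseCases (x y : ℕ) where
    open Colourings x
    open Weights x y

    P-E₁ : P E₁ x y ≡ x
    P-E₁ = trans (P-as-total E₁) (∑-ones x)

    P-∅ : P ∅G x y ≡ 1
    P-∅ = P-as-total ∅G

    W-⊕ : ∀ {m₁ m₂} (es₁ : List (Fin m₁ × Fin m₁)) (es₂ : List (Fin m₂ × Fin m₂)) (u : Vec (Fin x) m₁) (v : Vec (Fin x) m₂) →
          W (edges (graph m₁ es₁ ⊕ graph m₂ es₂)) (u Vec.++ v) ≡ W es₁ u * W es₂ v
    W-⊕ {m₁} {m₂} es₁ es₂ u v = trans (weight-++ (Vec.lookup (u Vec.++ v)) (map inl es₁) (map inr es₂))
      (cong₂ _*_ (weight-map (Vec.lookup u) (Vec.lookup (u Vec.++ v)) inl es₁ λ { (a , b) →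
                    edgeWeight-transport (Vec.lookup (u Vec.++ v)) (Vec.lookup u) (a ↑ˡ m₂) (b ↑ˡ m₂) a b
                      (Vec.lookup-++ˡ u v a) (Vec.lookup-++ˡ u v b) (↑ˡ-injective m₂ a b) })
                 (weight-map (Vec.lookup v) (Vec.lookup (u Vec.++ v)) inr es₂ λ { (a , b) →
                    edgeWeight-transport (Vec.lookup (u Vec.++ v)) (Vec.lookup v) (m₁ ↑ʳ a) (m₁ ↑ʳ b) a b
                      (Vec.lookup-++ʳ u v a) (Vec.lookup-++ʳ u v b) (↑ʳ-injective m₁ a b) }))
      where
      inl : Fin m₁ × Fin m₁ → Fin (m₁ + m₂) × Fin (m₁ + m₂)
      inl (a , b) = a ↑ˡ m₂ , b ↑ˡ m₂
      inr : Fin m₂ × Fin m₂ → Fin (m₁ + m₂) × Fin (m₁ + m₂)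
      inr (a , b) = m₁ ↑ʳ a , m₁ ↑ʳ b

    P-⊕ : ∀ G₁ G₂ → P (G₁ ⊕ G₂) x y ≡ P G₁ x y * P G₂ x y
    P-⊕ G₁@(graph m₁ es₁) G₂@(graph m₂ es₂) = begin
      P (G₁ ⊕ G₂) x y                                    ≡⟨ P-as-total (G₁ ⊕ G₂) ⟩
      total (m₁ + m₂) (W (edges (G₁ ⊕ G₂)))              ≡⟨ total-++ m₁ m₂ (W (edges (G₁ ⊕ G₂))) ⟩
      total m₁ (λ u → total m₂ (λ v → W (edges (G₁ ⊕ G₂)) (u Vec.++ v)))
        ≡⟨ total-cong m₁ (λ u → total-cong m₂ (W-⊕ es₁ es₂ u)) ⟩
      total m₁ (λ u → total m₂ (λ v → W es₁ u * W es₂ v))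
        ≡⟨ total-cong m₁ (λ u → total-*ˡ m₂ (W es₁ u) (W es₂)) ⟩
      total m₁ (λ u → W es₁ u * total m₂ (W es₂))        ≡⟨ total-*ʳ m₁ (total m₂ (W es₂)) (W es₁) ⟩
      total m₁ (W es₁) * total m₂ (W es₂)                ≡⟨ sym (cong₂ _*_ (P-as-total G₁) (P-as-total G₂)) ⟩
      P G₁ x y * P G₂ x y                                ∎

  module DeletionContraction (x y : ℕ) where
    open Colourings x
    open Weights x y

    -- Colour the vertex u of a loop with c: if c is proper the loop fails,
    -- if c is improper no edge at u imposes a condition.
    W-loop : ∀ {m} es (e : Fin (length es)) (u : Fin (suc m)) → lookup es e ≡ (u , u) →
             (c : Fin x) (w : Vec (Fin x) m) → W es (insertAt w u c) ≡ improper y c * W (deleteVertex u es) w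
    W-loop {m} es e u e≡uu c w with toℕ c <? y
    ... | no c∉Y  = trans (weight-deleteVertex u c c∉Y w es) (sym (+-identityʳ _))
    ... | yes c∈Y = begin
      weight φ es                                             ≡⟨ weight-removeAt φ es e ⟩
      edgeWeight φ (lookup es e) * weight φ (removeAt es e)   ≡⟨ cong (λ p → edgeWeight φ p * weight φ (removeAt es e)) e≡uu ⟩
      edgeWeight φ (u , u) * weight φ (removeAt es e)         ≡⟨ cong (_* weight φ (removeAt es e)) loop-fails ⟩
      0                                                       ∎
      where
      φ : Fin (suc m) → Fin x
      φ = Vec.lookup (insertAt w u c)
      loop-fails : edgeWeight φ (u , u) ≡ 0
      loop-fails = 𝟙-no (λ ok → proj₁ ok refl (subst (InY y) (sym (Vec.insertAt-lookup w u c)) c∈Y)) (edgeOK? y φ (u , u))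

    P-loop : ∀ {m} es (e : Fin (length es)) (u : Fin (suc m)) → lookup es e ≡ (u , u) →
             P (graph (suc m) es) x y ≡ (x ∸ y) * P (graph m (deleteVertex u es)) x y
    P-loop {m} es e u e≡uu = begin
      P (graph (suc m) es) x y                                         ≡⟨ P-as-total (graph (suc m) es) ⟩
      total (suc m) (W es)                                             ≡⟨ total-insertAt m u (W es) ⟩
      ∑[ c < x ] total m (λ w → W es (insertAt w u c))
        ≡⟨ sum-cong-≗ (λ c → trans (total-cong m (W-loop es e u e≡uu c)) (total-*ˡ m (improper y c) (W dag))) ⟩
      ∑[ c < x ] (improper y c * total m (W dag))                      ≡⟨ sym (*-distribʳ-sum {x} (total m (W dag)) (improper y)) ⟩
      (∑[ c < x ] improper y c) * total m (W dag)                      ≡⟨ cong (_* total m (W dag)) (∑-improper x y) ⟩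
      (x ∸ y) * total m (W dag)                                        ≡⟨ cong ((x ∸ y) *_) (sym (P-as-total (graph m dag))) ⟩
      (x ∸ y) * P (graph m dag) x y                                    ∎
      where
      dag : List (Fin m × Fin m)
      dag = deleteVertex u es

    -- Deletion–contraction for an edge e = {u,v} with u ≢ v.  Colourings of
    -- G are split by the colour c of v; w colours the other vertices.
    module NonLoop {m : ℕ} (es : List (Fin (suc (suc m)) × Fin (suc (suc m)))) (e : Fin (length es))
                   (u v : Fin (suc (suc m))) (u≢v : u ≢ v) (e≡uv : lookup es e ≡ (u , v)) where

      -- u as a vertex of G with v removed
      u′ : Fin (suc m)
      u′ = punchOut {i = v} {j = u} (λ v≡u → u≢v (sym v≡u))

      -- the edges of G_{-e}, of G_{/e} and of G_{†e}
      R : List (Fin (suc (suc m)) × Fin (suc (suc m)))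
      R = removeAt es e

      merged : List (Fin (suc m) × Fin (suc m))
      merged = map (λ { (a , b) → mergeMap u≢v a , mergeMap u≢v b }) R

      dag : List (Fin m × Fin m)
      dag = deleteVertex u′ (deleteVertex v es)

      -- weight of the edges other than e, and the two brackets of 'edgeWeight-split'
      A : Fin x → Vec (Fin x) (suc m) → ℕ
      A c w = W R (insertAt w v c)

      e-ok : Fin x → Vec (Fin x) (suc m) → ℕ
      e-ok c w = edgeWeight (Vec.lookup (insertAt w v c)) (u , v)

      same : Fin x → Vec (Fin x) (suc m) → ℕ
      same c w = 𝟙 (c ≟ Vec.lookup w u′)

      -- A colouring w of G_{/e} is the colouring of G giving v the colour of u.
      lookup-merge : ∀ (w : Vec (Fin x) (suc m)) a →
                     Vec.lookup (insertAt w v (Vec.lookup w u′)) a ≡ Vec.lookup w (mergeMap u≢v a)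
      lookup-merge w a with a ≟ v
      ... | yes refl = Vec.insertAt-lookup w a _
      ... | no a≢v   = lookup-insertAt-punchOut w v _ a (λ v≡a → a≢v (sym v≡a))

      split-G : P (graph (suc (suc m)) es) x y ≡ ∑[ c < x ] total (suc m) (λ w → e-ok c w * A c w)
      split-G = trans (P-as-total (graph (suc (suc m)) es)) (trans (total-insertAt (suc m) v (W es))
        (sum-cong-≗ (λ c → total-cong (suc m) (λ w →
          trans (weight-removeAt (Vec.lookup (insertAt w v c)) es e)
                (cong (λ p → edgeWeight (Vec.lookup (insertAt w v c)) p * A c w) e≡uv)))))

      split-delete : P (graph (suc (suc m)) R) x y ≡ ∑[ c < x ] total (suc m) (A c)
      split-delete = trans (P-as-total (graph (suc (suc m)) R)) (total-insertAt (suc m) v (W R))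

      split-contract : P (graph (suc m) merged) x y ≡ ∑[ c < x ] total (suc m) (λ w → same c w * A c w)
      split-contract = begin
        P (graph (suc m) merged) x y                         ≡⟨ P-as-total (graph (suc m) merged) ⟩
        total (suc m) (W merged)                             ≡⟨ total-cong (suc m) merged≡A ⟩
        total (suc m) (λ w → ∑[ c < x ] (same c w * A c w))  ≡⟨ total-∑ (suc m) x (λ c w → same c w * A c w) ⟩
        ∑[ c < x ] total (suc m) (λ w → same c w * A c w)    ∎
        where
        merged≡A : ∀ w → W merged w ≡ ∑[ c < x ] (same c w * A c w)
        merged≡A w = trans
          (weight-map (Vec.lookup (insertAt w v (Vec.lookup w u′))) (Vec.lookup w) _ R λ { (a , b) →
             sym (edgeWeight-transport (Vec.lookup (insertAt w v (Vec.lookup w u′))) (Vec.lookup w) a b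
                    (mergeMap u≢v a) (mergeMap u≢v b) (lookup-merge w a) (lookup-merge w b) (cong (mergeMap u≢v))) })
          (sym (∑-delta x (Vec.lookup w u′) (λ c → A c w)))

      -- If v and u both get the improper colour c, no edge at u or v matters.
      A-dagger : ∀ c → ¬ InY y c → ∀ z → A c (insertAt z u′ c) ≡ W dag z
      A-dagger c c∉Y z = begin
        weight φ R                              ≡⟨ sym (weight-drop φ (u , v) R e-free) ⟩
        weight φ ((u , v) ∷ R)                  ≡⟨ cong (λ p → weight φ (p ∷ R)) (sym e≡uv) ⟩
        weight φ (lookup es e ∷ R)              ≡⟨ sym (weight-removeAt φ es e) ⟩
        W es (insertAt (insertAt z u′ c) v c)   ≡⟨ weight-deleteVertex v c c∉Y (insertAt z u′ c) es ⟩
        W (deleteVertex v es) (insertAt z u′ c) ≡⟨ weight-deleteVertex u′ c c∉Y z (deleteVertex v es) ⟩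
        W dag z                                 ∎
        where
        φ : Fin (suc (suc m)) → Fin x
        φ = Vec.lookup (insertAt (insertAt z u′ c) v c)
        e-free : edgeWeight φ (u , v) ≡ 1
        e-free = edgeWeight-improper φ u v
                   (inj₂ (subst (λ t → ¬ InY y t) (sym (Vec.insertAt-lookup (insertAt z u′ c) v c)) c∉Y))

      dagger-term : ∀ c → improper y c * total (suc m) (λ w → same c w * A c w) ≡ improper y c * P (graph m dag) x y
      dagger-term c with toℕ c <? y
      ... | yes _   = refl
      ... | no c∉Y  = cong (_+ 0) (begin
        total (suc m) (λ w → same c w * A c w)
          ≡⟨ total-insertAt m u′ (λ w → same c w * A c w) ⟩
        ∑[ d < x ] total m (λ z → same c (insertAt z u′ d) * A c (insertAt z u′ d))
          ≡⟨ sum-cong-≗ (λ d → total-cong m (λ z →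
               cong (λ t → 𝟙 (c ≟ t) * A c (insertAt z u′ d)) (Vec.insertAt-lookup z u′ d))) ⟩
        ∑[ d < x ] total m (λ z → 𝟙 (c ≟ d) * A c (insertAt z u′ d))
          ≡⟨ sum-cong-≗ (λ d → total-*ˡ m (𝟙 (c ≟ d)) (λ z → A c (insertAt z u′ d))) ⟩
        ∑[ d < x ] (𝟙 (c ≟ d) * total m (λ z → A c (insertAt z u′ d)))
          ≡⟨ ∑-delta′ x c (λ d → total m (λ z → A c (insertAt z u′ d))) ⟩
        total m (λ z → A c (insertAt z u′ c))   ≡⟨ total-cong m (A-dagger c c∉Y) ⟩
        total m (W dag)                         ≡⟨ sym (P-as-total (graph m dag)) ⟩
        P (graph m dag) x y                     ∎)

      -- 'edgeWeight-split' summed over the colourings with v coloured c.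
      per-colour : ∀ c → total (suc m) (λ w → e-ok c w * A c w) + total (suc m) (λ w → same c w * A c w)
                         ≡ total (suc m) (A c) + improper y c * P (graph m dag) x y
      per-colour c = begin
        total (suc m) (λ w → e-ok c w * A c w) + total (suc m) (λ w → same c w * A c w)
          ≡⟨ sym (total-+ (suc m) (λ w → e-ok c w * A c w) (λ w → same c w * A c w)) ⟩
        total (suc m) (λ w → e-ok c w * A c w + same c w * A c w)
          ≡⟨ total-cong (suc m) pointwise ⟩
        total (suc m) (λ w → A c w + improper y c * (same c w * A c w))
          ≡⟨ total-+ (suc m) (A c) (λ w → improper y c * (same c w * A c w)) ⟩
        total (suc m) (A c) + total (suc m) (λ w → improper y c * (same c w * A c w))
          ≡⟨ cong (total (suc m) (A c) +_) (trans (total-*ˡ (suc m) (improper y c) (λ w → same c w * A c w)) (dagger-term c)) ⟩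
        total (suc m) (A c) + improper y c * P (graph m dag) x y ∎
        where
        open +-*-Solver using (solve; _:=_; _:+_; _:*_; con)
        rearrange : ∀ a s k → a * (1 + s * k) ≡ a + k * (s * a)
        rearrange = solve 3 (λ a s k → a :* (con 1 :+ s :* k) := a :+ k :* (s :* a)) refl
        pointwise : ∀ w → e-ok c w * A c w + same c w * A c w ≡ A c w + improper y c * (same c w * A c w)
        pointwise w = begin
          e-ok c w * A c w + same c w * A c w   ≡⟨ sym (*-distribʳ-+ (A c w) (e-ok c w) (same c w)) ⟩
          (e-ok c w + same c w) * A c w         ≡⟨ cong (_* A c w) (edgeWeight-split (Vec.lookup (insertAt w v c)) u v u≢v c _
                                                      (lookup-insertAt-punchOut w v c u (λ v≡u → u≢v (sym v≡u)))
                                                      (Vec.insertAt-lookup w v c)) ⟩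
          (1 + same c w * improper y c) * A c w ≡⟨ *-comm (1 + same c w * improper y c) (A c w) ⟩
          A c w * (1 + same c w * improper y c) ≡⟨ rearrange (A c w) (same c w) (improper y c) ⟩
          A c w + improper y c * (same c w * A c w) ∎

      P-nonLoop : P (graph (suc (suc m)) es) x y + P (graph (suc m) merged) x y
                  ≡ P (graph (suc (suc m)) R) x y + (x ∸ y) * P (graph m dag) x y
      P-nonLoop = begin
        P (graph (suc (suc m)) es) x y + P (graph (suc m) merged) x y
          ≡⟨ cong₂ _+_ split-G split-contract ⟩
        ∑[ c < x ] total (suc m) (λ w → e-ok c w * A c w) + ∑[ c < x ] total (suc m) (λ w → same c w * A c w)
          ≡⟨ sym (∑-distrib-+ (λ c → total (suc m) (λ w → e-ok c w * A c w)) (λ c → total (suc m) (λ w → same c w * A c w))) ⟩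
        ∑[ c < x ] (total (suc m) (λ w → e-ok c w * A c w) + total (suc m) (λ w → same c w * A c w))
          ≡⟨ sum-cong-≗ per-colour ⟩
        ∑[ c < x ] (total (suc m) (A c) + improper y c * D)
          ≡⟨ ∑-distrib-+ (λ c → total (suc m) (A c)) (λ c → improper y c * D) ⟩
        ∑[ c < x ] total (suc m) (A c) + ∑[ c < x ] (improper y c * D)
          ≡⟨ cong₂ _+_ (sym split-delete) (sym (*-distribʳ-sum {x} D (improper y))) ⟩
        P (graph (suc (suc m)) R) x y + (∑[ c < x ] improper y c) * D
          ≡⟨ cong (λ t → P (graph (suc (suc m)) R) x y + t * D) (∑-improper x y) ⟩
        P (graph (suc (suc m)) R) x y + (x ∸ y) * D ∎
        where
        D : ℕ
        D = P (graph m dag) x y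

    deletion-contraction : ∀ G (e : Edge G) →
      P G x y + P (contract G e) x y ≡ P (deleteEdge G e) x y + (x ∸ y) * P (dagger G e) x y
    deletion-contraction (graph zero es) e with lookup es e
    ... | () , _
    deletion-contraction (graph (suc m) es) e with lookup es e in e≡uv
    ... | u , v with u ≟ v
    ...   | yes refl = trans (cong (_+ P (graph (suc m) (removeAt es e)) x y) (P-loop es e u e≡uv))
                             (+-comm ((x ∸ y) * P (graph m (deleteVertex u es)) x y) _)
    deletion-contraction (graph (suc zero)    es) e | zero , zero | no u≢v = ⊥-elim (u≢v refl)
    deletion-contraction (graph (suc (suc m)) es) e | u , v       | no u≢v = NonLoop.P-nonLoop es e u v u≢v e≡uv

-- Deletion–contraction in ℤ, where x ∸ y becomes x - y as y ≤ x.
module IntegerForm where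
  open import Data.Nat using (_+_; _*_; _∸_; _≤_)
  open import Data.Integer using (+_) renaming (_+_ to _+ℤ_; _-_ to _-ℤ_; _*_ to _*ℤ_)
  open import Data.Integer.Properties using (pos-+; pos-*; m-n≡m⊖n; ⊖-≥)
  open import Data.Integer.Solver using (module +-*-Solver)
  open import Relation.Binary.PropositionalEquality using (refl; cong; sym; trans; module ≡-Reasoning)
  open +-*-Solver using (solve; _:=_; _:+_; _:-_)
  open ≡-Reasoning

  move-to-ℤ : ∀ {x y} a b c d → y ≤ x → a + c ≡ b + (x ∸ y) * d →
              + a ≡ (+ b -ℤ + c) +ℤ (+ x -ℤ + y) *ℤ + d
  move-to-ℤ {x} {y} a b c d y≤x eq = begin
    + a                                   ≡⟨ solve 2 (λ a c → a := (a :+ c) :- c) refl (+ a) (+ c) ⟩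
    (+ a +ℤ + c) -ℤ + c                   ≡⟨ cong (_-ℤ + c) (sym (pos-+ a c)) ⟩
    + (a + c) -ℤ + c                      ≡⟨ cong (λ t → + t -ℤ + c) eq ⟩
    + (b + (x ∸ y) * d) -ℤ + c            ≡⟨ cong (_-ℤ + c) (trans (pos-+ b _) (cong (+ b +ℤ_) (pos-* (x ∸ y) d))) ⟩
    (+ b +ℤ + (x ∸ y) *ℤ + d) -ℤ + c      ≡⟨ cong (λ t → (+ b +ℤ t *ℤ + d) -ℤ + c) x-y ⟩
    (+ b +ℤ (+ x -ℤ + y) *ℤ + d) -ℤ + c   ≡⟨ solve 3 (λ b c k → (b :+ k) :- c := (b :- c) :+ k) refl (+ b) (+ c) _ ⟩
    (+ b -ℤ + c) +ℤ (+ x -ℤ + y) *ℤ + d   ∎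
    where
    x-y : + (x ∸ y) ≡ + x -ℤ + y
    x-y = sym (trans (m-n≡m⊖n x y) (⊖-≥ y≤x))

open import Data.Integer using (ℤ; +_; _+_; _-_; _*_)
open import Data.Product using (_,_)
open import Data.Nat.Properties using (<⇒≤)

mainTheorem5 : (x y : ℕ) → 0 < y → y < x →
    ((G : Graph) (e : Edge G) →
       + P G x y ≡ (+ P (deleteEdge G e) x y - + P (contract G e) x y)
                   + (+ x - + y) * + P (dagger G e) x y)
    × ((G₁ G₂ : Graph) → P (G₁ ⊕ G₂) x y ≡ P G₁ x y Data.Nat.* P G₂ x y)
    × P E₁ x y ≡ x
    × P ∅G x y ≡ 1
mainTheorem5 x y _ y<x =
    (λ G e → move-to-ℤ _ _ _ _ (<⇒≤ y<x) (deletion-contraction G e))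
  , P-⊕ , P-E₁ , P-∅
  where
  open Counting.DeletionContraction x y using (deletion-contraction)
  open Counting.UnionAndBaseCases x y using (P-⊕; P-E₁; P-∅)
  open IntegerForm using (move-to-ℤ)
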